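{- For every prime power $q$, the function $n\mapsto\varrho(n,q)$ is increasing in the weak sense: $\varrho(k,q)\le\varrho(n,q)$ for all integers $2\le k\le n$.
   Context: $\mathrm{PG}(n,q)$ is the $n$-dimensional projective space over $\mathbb{F}_q$. A $(2,1)$-blocking set in $\mathrm{PG}(n,q)$ is a set of lines such that every plane contains at least one of them; $f(n,q)$ is the minimum size of such a set. The density is $\varrho(n,q)=f(n,q)/\binom{n+1}{2}_q$, where $\binom{n+1}{2}_q=\frac{(q^{n+1}-1)(q^n-1)}{(q^2-1)(q-1)}$ is the number of lines of $\mathrm{PG}(n,q)$. -}

module Defs where

open import Level using (0ℓ)
open import Data.Nat as ℕ using (ℕ; zero; suc; _+_; _*_; _∸_; _^_; _≤_; _<_; s≤s; z≤n; NonZero)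
open import Data.Nat.Properties as ℕP
open import Data.Nat.DivMod using (_/_)
import Data.Nat.DivMod as DM
open import Data.Fin using (Fin)
open import Data.Integer using (+_)
open import Data.Rational using (ℚ; 0ℚ) renaming (_/_ to _/ℚ_)
open import Data.List using (List; length)
open import Data.List.Relation.Unary.Any using (Any)
open import Data.List.Relation.Unary.All using (All)
open import Data.List.Relation.Unary.AllPairs using (AllPairs)
open import Data.Product using (Σ; _×_; _,_; ∃)
open import Data.Empty using (⊥-elim)
open import Function.Bundles using (_↔_; Inverse)
open import Relation.Nullary using (¬_)
open import Relation.Binary.PropositionalEquality
open import Algebra.Structures using (IsCommutativeRing)

record FiniteField : Set₁ where
  infixl 7 _*F_
  infixl 6 _+F_
  field
    Carrier : Set
    _+F_ _*F_ : Carrier → Carrier → Carrier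
    -F_ : Carrier → Carrier
    0F 1F : Carrier
    isCommutativeRing : IsCommutativeRing _≡_ _+F_ _*F_ -F_ 0F 1F
    0≢1 : 0F ≢ 1F
    inverse : ∀ x → x ≢ 0F → Σ Carrier (λ y → x *F y ≡ 1F)
    size : ℕ
    enum : Carrier ↔ Fin size

module Geometry (F : FiniteField) where
  open FiniteField F

  q : ℕ
  q = size

  -- vectors of F^(n+1), the underlying space of PG(n,q)
  Vec : ℕ → Set
  Vec n = Fin (suc n) → Carrier

  _≈_ : ∀ {n} → Vec n → Vec n → Set
  u ≈ v = ∀ j → u j ≡ v j

  zeroV : ∀ {n} → Vec n
  zeroV _ = 0F

  lincomb : ∀ {n} r → (Fin r → Carrier) → (Fin r → Vec n) → Vec n
  lincomb zero c u j = 0F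
  lincomb (suc r) c u j = c Fin.zero *F u Fin.zero j +F lincomb r (λ i → c (Fin.suc i)) (λ i → u (Fin.suc i)) j

  LinIndep : ∀ {n} r → (Fin r → Vec n) → Set
  LinIndep r u = ∀ c → lincomb r c u ≈ zeroV → ∀ i → c i ≡ 0F

  InSpan : ∀ {n} r → Vec n → (Fin r → Vec n) → Set
  InSpan r v u = Σ (Fin r → Carrier) λ c → v ≈ lincomb r c u

  -- a k-dimensional vector subspace (projective (k-1)-space), given by a basis
  record Subspace (n k : ℕ) : Set where
    constructor subspace
    field
      basis : Fin k → Vec n
      indep : LinIndep k basis

  _⊆_ : ∀ {n k l} → Subspace n k → Subspace n l → Set
  _⊆_ {l = l} U W = ∀ i → InSpan l (Subspace.basis U i) (Subspace.basis W)

  _≐_ : ∀ {n k} → Subspace n k → Subspace n k → Set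
  U ≐ W = (U ⊆ W) × (W ⊆ U)

  Line : ℕ → Set
  Line n = Subspace n 2

  Plane : ℕ → Set
  Plane n = Subspace n 3

  -- a (2,1)-blocking set: a finite set (duplicate-free list, up to equality
  -- of lines) of lines such that every plane contains one of them
  IsBlockingSet : ∀ n → List (Line n) → Set
  IsBlockingSet n B = AllPairs (λ l m → ¬ (l ≐ m)) B
                    × (∀ (π : Plane n) → Any (λ l → l ⊆ π) B)

  -- f(n,q) = m : m is the minimum size of a (2,1)-blocking set in PG(n,q)
  IsMinBlockingSize : ℕ → ℕ → Set
  IsMinBlockingSize n m =
    Σ (List (Line n)) (λ B → IsBlockingSet n B × length B ≡ m)
    × (∀ B → IsBlockingSet n B → m ≤ length B)

  private
    open Inverse enum
    q≥2 : 2 ≤ q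
    q≥2 with size | to | from | strictlyInverseʳ
    ... | zero | t | _ | _ with t 0F
    ...   | ()
    q≥2 | suc zero | t | fr | inv = ⊥-elim (0≢1 (begin
            0F ≡⟨ sym (inv 0F) ⟩ fr (t 0F) ≡⟨ cong fr (lem (t 0F) (t 1F)) ⟩
            fr (t 1F) ≡⟨ inv 1F ⟩ 1F ∎))
      where
        open ≡-Reasoning
        lem : (a b : Fin 1) → a ≡ b
        lem Fin.zero Fin.zero = refl
    q≥2 | suc (suc s) | _ | _ | _ = s≤s (s≤s z≤n)

    pos : ∀ m → 1 ≤ q ^ suc m ∸ 1
    pos m = ℕP.∸-monoˡ-≤ 1 (ℕP.≤-trans q≥2 (ℕP.≤-trans (ℕP.≤-reflexive (sym (ℕP.*-identityʳ q)))
              (ℕP.*-monoʳ-≤ q (ℕP.m^n>0 q {{ℕ.>-nonZero (ℕP.≤-trans (s≤s z≤n) q≥2)}} m))))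

    nz : ∀ {x} → 1 ≤ x → NonZero x
    nz {suc x} _ = _

    q∸1≥1 : 1 ≤ q ∸ 1
    q∸1≥1 = ℕP.≤-trans (pos 0) (ℕP.≤-reflexive (cong (_∸ 1) (ℕP.*-identityʳ q)))

    q>0 : NonZero q
    q>0 = ℕ.>-nonZero (ℕP.≤-trans (s≤s z≤n) q≥2)

    den : ℕ
    den = (q ^ 2 ∸ 1) * (q ∸ 1)

    instance
      den≢0 : NonZero den
      den≢0 = ℕP.m*n≢0 _ _ {{nz (pos 1)}} {{nz q∸1≥1}}

  numLines : ℕ → ℕ
  numLines n = ((q ^ suc n ∸ 1) * (q ^ n ∸ 1)) / den

  private
    num≥den : ∀ m → den ≤ (q ^ suc (suc m) ∸ 1) * (q ^ suc m ∸ 1)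
    num≥den m = ℕP.*-mono-≤ (ℕP.∸-monoˡ-≤ 1 (ℕP.^-monoʳ-≤ q {{q>0}} {2} {suc (suc m)} (s≤s (s≤s z≤n))))
                  (ℕP.≤-trans (ℕP.≤-reflexive (cong (_∸ 1) (sym (ℕP.*-identityʳ q))))
                     (ℕP.∸-monoˡ-≤ 1 (ℕP.^-monoʳ-≤ q {{q>0}} {1} {suc m} (s≤s z≤n))))

    numLines≢0 : ∀ m → NonZero (numLines (suc m))
    numLines≢0 m = nz (DM.m≥n⇒m/n>0 (num≥den m))

  -- density ϱ(n,q) = f(n,q) / (number of lines of PG(n,q)), as a rational
  -- number; defined for n ≥ 1 (PG(0,q) has no lines; the value 0 is junk
  -- and never used below, where n ≥ 2).
  ρ : ℕ → ℕ → ℚ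
  ρ zero f = 0ℚ
  ρ (suc m) f = _/ℚ_ (+ f) (numLines (suc m)) {{numLines≢0 m}}

{-# OPTIONS --safe #-}
module Submission where

open import Defs
open import Data.Nat using (ℕ; _≤_)
open import Data.Rational using () renaming (_≤_ to _≤ℚ_)

open import Algebra.Bundles using (CommutativeRing)
import Algebra.Properties.CommutativeSemigroup as CommutativeSemigroupProperties
import Algebra.Properties.Ring as RingProperties
import Algebra.Properties.Semiring.Sum as SemiringSum
open import Data.Fin as Fin using (Fin; punchIn; _≟_)
import Data.Fin.Properties as FinP
import Data.Integer as ℤ
import Data.Integer.Properties as ℤP
open import Data.List using (List; []; _∷_; length; lookup)
open import Data.List.Relation.Unary.All using (All; []; _∷_)
open import Data.List.Relation.Unary.AllPairs using (AllPairs; []; _∷_)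
open import Data.List.Relation.Unary.Any using (Any; here; there)
open import Data.Nat using (zero; suc; _+_; _*_; _^_; _∸_; z≤n; s≤s; NonZero; >-nonZero; _≤′_; ≤′-refl; ≤′-step)
import Data.Nat.DivMod as DivMod
import Data.Nat.Properties as ℕP
open import Data.Nat.Tactic.RingSolver using (solve-∀)
open import Data.Product using (_,_; proj₁; proj₂)
import Data.Rational as ℚ
import Data.Rational.Properties as ℚP
import Data.Rational.Unnormalised as ℚᵘ
import Data.Rational.Unnormalised.Properties as ℚᵘP
open import Data.Vec.Functional using (Vector; tail; insertAt; removeAt) renaming ([] to []ᵥ; _∷_ to _∷ᵥ_)
open import Data.Vec.Functional.Properties using (insertAt-punchIn; insertAt-lookup; insertAt-removeAt)
open import Function using (_∘_)
open import Function.Bundles using (Inverse)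
open import Level using (0ℓ)
open import Relation.Binary.PropositionalEquality
open import Relation.Nullary using (¬_; Dec; yes; no; contradiction)
open import Relation.Nullary.Decidable using (¬?; _×-dec_)
open import Algebra.Properties.Semiring.Sum ℕP.+-*-semiring
  using (sum; sum-syntax; sum-cong-≗; sum-remove; sum-replicate-zero; ∑-distrib-+; ∑-comm; *-distribˡ-sum)

-- Averaging over hyperplanes.  Let B be a blocking set of PG(n+1,q) and suppose every blocking
-- set of PG(n,q) has at least b lines.  For a ≠ 0 the lines of B lying in the hyperplane
-- a^⊥ ≅ PG(n,q) block every plane of a^⊥, so there are at least b of them.  Summing over the
-- q^(n+2) - 1 nonzero vectors a, and using that a line lies in a^⊥ for exactly q^n - 1 of them,
-- gives b (q^(n+2) - 1) ≤ |B| (q^n - 1).  As the numbers of lines satisfy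
-- N(n+1) (q^n - 1) = N(n) (q^(n+2) - 1), every lower bound for |B′| / N(n) over blocking sets of
-- PG(n,q) is one for |B| / N(n+1) as well; starting from f(k) / N(k) this gives ρ(k) ≤ ρ(n).

𝟙 : {P : Set} → Dec P → ℕ
𝟙 (yes _) = 1
𝟙 (no _)  = 0

𝟙-cong : {P Q : Set} → (P → Q) → (Q → P) → (p : Dec P) (r : Dec Q) → 𝟙 p ≡ 𝟙 r
𝟙-cong f g (yes _) (yes _) = refl
𝟙-cong f g (yes p) (no ¬r) = contradiction (f p) ¬r
𝟙-cong f g (no ¬p) (yes r) = contradiction (g r) ¬p
𝟙-cong f g (no _)  (no _)  = refl

𝟙-yes : {P : Set} → P → (d : Dec P) → 𝟙 d ≡ 1
𝟙-yes p d = 𝟙-cong (λ _ → p) (λ _ → p) d (yes p)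

𝟙-no : {P : Set} → ¬ P → (d : Dec P) → 𝟙 d ≡ 0
𝟙-no ¬p d = 𝟙-cong ¬p (λ ()) d (no λ ())

𝟙-×-dec : {P Q : Set} (p : Dec P) (r : Dec Q) → 𝟙 (p ×-dec r) ≡ 𝟙 p * 𝟙 r
𝟙-×-dec (yes _) (yes _) = refl
𝟙-×-dec (yes _) (no _)  = refl
𝟙-×-dec (no _)  _       = refl

sum-const : ∀ n k → ∑[ i < n ] k ≡ n * k
sum-const zero    k = refl
sum-const (suc n) k = cong (k +_) (sum-const n k)

sum-mono-≤ : ∀ {n} {f g : Vector ℕ n} → (∀ i → f i ≤ g i) → sum f ≤ sum g
sum-mono-≤ {zero}  f≤g = z≤n
sum-mono-≤ {suc n} f≤g = ℕP.+-mono-≤ (f≤g Fin.zero) (sum-mono-≤ (f≤g ∘ Fin.suc))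

sum-𝟙-≟ : ∀ {n} (j : Fin n) → ∑[ i < n ] 𝟙 (i ≟ j) ≡ 1
sum-𝟙-≟ {suc n} j = begin
  ∑[ i < suc n ] 𝟙 (i ≟ j)                         ≡⟨ sum-remove {i = j} (λ i → 𝟙 (i ≟ j)) ⟩
  𝟙 (j ≟ j) + ∑[ k < n ] 𝟙 (punchIn j k ≟ j)      ≡⟨ cong₂ _+_ (𝟙-yes refl (j ≟ j))
                                                       (sum-cong-≗ (λ k → 𝟙-no (FinP.punchInᵢ≢i j k) _)) ⟩
  1 + ∑[ k < n ] 0                                  ≡⟨ cong suc (sum-replicate-zero n) ⟩
  1                                                 ∎
  where open ≡-Reasoning

+1≡⇒≡∸1 : ∀ {m n} → m + 1 ≡ n → m ≡ n ∸ 1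
+1≡⇒≡∸1 {m} refl = sym (ℕP.m+n∸n≡m m 1)

+-*-swap-cancel : ∀ q a b → 2 ≤ q → a + q * b ≡ b + q * a → a ≡ b
+-*-swap-cancel (suc (suc r)) a b (s≤s (s≤s z≤n)) eq =
  ℕP.*-cancelˡ-≡ a b (suc r) (ℕP.+-cancelˡ-≡ (a + b) _ _ (begin
  a + b + suc r * a      ≡⟨ peel r a b ⟩
  b + suc (suc r) * a    ≡⟨ eq ⟨
  a + suc (suc r) * b    ≡⟨ peel r b a ⟨
  b + a + suc r * b      ≡⟨ cong (_+ suc r * b) (ℕP.+-comm b a) ⟩
  a + b + suc r * b      ∎))
  where
  open ≡-Reasoning
  peel : ∀ r x y → x + y + suc r * x ≡ y + suc (suc r) * x
  peel = solve-∀

double-count : ∀ q X K Z → 2 ≤ q →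
               X + K ≡ q ^ 2 * K + q * K → X + q * Z ≡ q * K * q + q ^ 2 * Z → K ≡ q * Z
double-count q X K Z 2≤q by-first by-second = +-*-swap-cancel q K (q * Z) 2≤q (ℕP.+-cancelˡ-≡ X _ _ (begin
  X + (K + q * (q * Z))          ≡⟨ ℕP.+-assoc X K _ ⟨
  X + K + q * (q * Z)            ≡⟨ cong (_+ q * (q * Z)) by-first ⟩
  q ^ 2 * K + q * K + q * (q * Z) ≡⟨ regroup q K Z ⟩
  q * K * q + q ^ 2 * Z + q * K  ≡⟨ cong (_+ q * K) by-second ⟨
  X + q * Z + q * K              ≡⟨ ℕP.+-assoc X (q * Z) (q * K) ⟩
  X + (q * Z + q * K)            ∎))
  where
  open ≡-Reasoning
  regroup : ∀ q k z → q * (q * 1) * k + q * k + q * (q * z) ≡ q * k * q + q * (q * 1) * z + q * k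
  regroup = solve-∀

*≤*⇒/≤/ : ∀ a b c d .{{_ : NonZero b}} .{{_ : NonZero d}} →
           a * d ≤ c * b → (ℤ.+ a) ℚ./ b ≤ℚ (ℤ.+ c) ℚ./ d
*≤*⇒/≤/ a (suc b) c (suc d) ad≤cb = ℚP.toℚᵘ-cancel-≤
  (ℚᵘP.≤-respˡ-≃ (ℚᵘP.≃-sym (ℚP.toℚᵘ-fromℚᵘ p))
    (ℚᵘP.≤-respʳ-≃ (ℚᵘP.≃-sym (ℚP.toℚᵘ-fromℚᵘ r)) p≤r))
  where
  p = ℚᵘ.mkℚᵘ (ℤ.+ a) b
  r = ℚᵘ.mkℚᵘ (ℤ.+ c) d
  p≤r : p ℚᵘ.≤ r
  p≤r = ℚᵘ.*≤* (subst₂ ℤ._≤_ (ℤP.pos-* a (suc d)) (ℤP.pos-* c (suc b)) (ℤ.+≤+ ad≤cb))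

module _ (q : ℕ) where

  qint : ℕ → ℕ
  qint zero    = 0
  qint (suc m) = 1 + q * qint m

  -- the Gaussian binomial [m+1 choose 2]_q, by the q-Pascal rule
  lineCount : ℕ → ℕ
  lineCount zero    = 0
  lineCount (suc m) = qint (suc m) + q * q * lineCount m

  qint*qint-suc : ∀ m → qint m * qint (suc m) ≡ qint 2 * lineCount m
  qint*qint-suc zero    = sym (ℕP.*-zeroʳ (qint 2))
  qint*qint-suc (suc m) = begin
    (1 + q * x) * (1 + q * (1 + q * x))
      ≡⟨ expand q x ⟩
    (1 + q * x) * (1 + q) + q * q * (x * (1 + q * x))
      ≡⟨ cong (λ t → (1 + q * x) * (1 + q) + q * q * t) (qint*qint-suc m) ⟩
    (1 + q * x) * (1 + q) + q * q * (qint 2 * h)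
      ≡⟨ factor q x h ⟩
    qint 2 * ((1 + q * x) + q * q * h) ∎
    where
    open ≡-Reasoning
    x = qint m
    h = lineCount m
    expand : ∀ q x → (1 + q * x) * (1 + q * (1 + q * x)) ≡ (1 + q * x) * (1 + q) + q * q * (x * (1 + q * x))
    expand = solve-∀
    factor : ∀ q x h → (1 + q * x) * (1 + q) + q * q * ((1 + q * (1 + q * 0)) * h) ≡
                       (1 + q * (1 + q * 0)) * ((1 + q * x) + q * q * h)
    factor = solve-∀

suc^≡suc[*qint] : ∀ p m → suc p ^ m ≡ suc (p * qint (suc p) m)
suc^≡suc[*qint] p zero    = cong suc (sym (ℕP.*-zeroʳ p))
suc^≡suc[*qint] p (suc m) = trans (cong (suc p *_) (suc^≡suc[*qint] p m)) (expand p (qint (suc p) m))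
  where
  expand : ∀ p x → suc p * suc (p * x) ≡ suc (p * (1 + suc p * x))
  expand = solve-∀

^∸1≡[∸1]*qint : ∀ q m → q ^ m ∸ 1 ≡ (q ∸ 1) * qint q m
^∸1≡[∸1]*qint zero    zero    = refl
^∸1≡[∸1]*qint zero    (suc m) = refl
^∸1≡[∸1]*qint (suc p) m       = cong (_∸ 1) (suc^≡suc[*qint] p m)

[^suc∸1]*[^∸1]≡lineCount*[[^2∸1]*[∸1]] : ∀ q m →
  (q ^ suc m ∸ 1) * (q ^ m ∸ 1) ≡ lineCount q m * ((q ^ 2 ∸ 1) * (q ∸ 1))
[^suc∸1]*[^∸1]≡lineCount*[[^2∸1]*[∸1]] q m = begin
  (q ^ suc m ∸ 1) * (q ^ m ∸ 1)           ≡⟨ cong₂ _*_ (^∸1≡[∸1]*qint q (suc m)) (^∸1≡[∸1]*qint q m) ⟩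
  (p * qint q (suc m)) * (p * qint q m)   ≡⟨ regroup p (qint q m) (qint q (suc m)) ⟩
  p * p * (qint q m * qint q (suc m))     ≡⟨ cong (p * p *_) (qint*qint-suc q m) ⟩
  p * p * (qint q 2 * lineCount q m)      ≡⟨ regroup′ p (qint q 2) (lineCount q m) ⟩
  lineCount q m * ((p * qint q 2) * p)    ≡⟨ cong (λ t → lineCount q m * (t * p)) (^∸1≡[∸1]*qint q 2) ⟨
  lineCount q m * ((q ^ 2 ∸ 1) * p)       ∎
  where
  open ≡-Reasoning
  p = q ∸ 1
  regroup : ∀ p a b → (p * b) * (p * a) ≡ p * p * (a * b)
  regroup = solve-∀
  regroup′ : ∀ p g h → p * p * (g * h) ≡ h * ((p * g) * p)
  regroup′ = solve-∀

lineCount-suc-ratio : ∀ q m → lineCount q (suc m) * (q ^ m ∸ 1) ≡ lineCount q m * (q ^ suc (suc m) ∸ 1)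
lineCount-suc-ratio q m = ℕP.*-cancelˡ-≡ (lineCount q (suc m) * (q ^ m ∸ 1)) _ (qint q 2) (begin
  qint q 2 * (lineCount q (suc m) * (q ^ m ∸ 1))
    ≡⟨ ℕP.*-assoc (qint q 2) (lineCount q (suc m)) (q ^ m ∸ 1) ⟨
  qint q 2 * lineCount q (suc m) * (q ^ m ∸ 1)
    ≡⟨ cong₂ _*_ (sym (qint*qint-suc q (suc m))) (^∸1≡[∸1]*qint q m) ⟩
  b * c * (p * a)
    ≡⟨ swap a b c p ⟩
  a * b * (p * c)
    ≡⟨ cong₂ _*_ (qint*qint-suc q m) (sym (^∸1≡[∸1]*qint q (suc (suc m)))) ⟩
  qint q 2 * lineCount q m * (q ^ suc (suc m) ∸ 1)
    ≡⟨ ℕP.*-assoc (qint q 2) (lineCount q m) (q ^ suc (suc m) ∸ 1) ⟩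
  qint q 2 * (lineCount q m * (q ^ suc (suc m) ∸ 1)) ∎)
  where
  open ≡-Reasoning
  p = q ∸ 1
  a = qint q m
  b = qint q (suc m)
  c = qint q (suc (suc m))
  swap : ∀ a b c p → b * c * (p * a) ≡ a * b * (p * c)
  swap = solve-∀

Fin-≤1-unique : ∀ {n} → n ≤ 1 → (i j : Fin n) → i ≡ j
Fin-≤1-unique {suc zero}    _             Fin.zero Fin.zero = refl
Fin-≤1-unique {suc (suc _)} (s≤s ())      _        _

insertAt-cong : ∀ {A : Set} {n} {xs ys : Vector A n} → (∀ j → xs j ≡ ys j) →
                ∀ i v j → insertAt xs i v j ≡ insertAt ys i v j
insertAt-cong             xs≗ys Fin.zero    v Fin.zero    = refl
insertAt-cong             xs≗ys Fin.zero    v (Fin.suc j) = xs≗ys j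
insertAt-cong {n = suc n} xs≗ys (Fin.suc i) v Fin.zero    = xs≗ys Fin.zero
insertAt-cong {n = suc n} xs≗ys (Fin.suc i) v (Fin.suc j) = insertAt-cong (xs≗ys ∘ Fin.suc) i v j

module _ (F : FiniteField) where
  open FiniteField F
  open Geometry F
  open Inverse enum using (to; from; inverseˡ; inverseʳ; strictlyInverseʳ)

  ring : CommutativeRing 0ℓ 0ℓ
  ring = record { isCommutativeRing = isCommutativeRing }

  open CommutativeRing ring
    using (-‿inverseˡ; +-identityʳ; *-comm; *-assoc; *-identityʳ; zeroˡ; zeroʳ; distribˡ;
           semiring; *-commutativeSemigroup)
  open RingProperties (CommutativeRing.ring ring)
    using (\\-leftDividesˡ; \\-leftDividesʳ; -‿involutive; +-inverseʳ-unique)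
  open CommutativeSemigroupProperties *-commutativeSemigroup using (x∙yz≈y∙xz)
  module 𝔽 = SemiringSum semiring

  infix 4 _≟F_
  _≟F_ : (x y : Carrier) → Dec (x ≡ y)
  x ≟F y with to x Fin.≟ to y
  ... | yes e = yes (trans (sym (strictlyInverseʳ x)) (inverseʳ e))
  ... | no ne = no (ne ∘ cong to)

  q≥2 : 2 ≤ q
  q≥2 = ℕP.≰⇒> λ q≤1 →
    0≢1 (trans (sym (strictlyInverseʳ 0F)) (inverseʳ (Fin-≤1-unique q≤1 (to 0F) (to 1F))))

  instance
    q-nonZero : NonZero q
    q-nonZero = >-nonZero (ℕP.<-trans (s≤s z≤n) q≥2)

  infix 8 _·_
  _·_ : ∀ {m} → Vector Carrier m → Vector Carrier m → Carrier
  a · b = 𝔽.sum (λ j → a j *F b j)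

  IsZero : ∀ {m} → Vector Carrier m → Set
  IsZero x = ∀ j → x j ≡ 0F

  isZero? : ∀ {m} (x : Vector Carrier m) → Dec (IsZero x)
  isZero? x = FinP.all? (λ j → x j ≟F 0F)

  ·-cong : ∀ {m} {a a′ b b′ : Vector Carrier m} →
           (∀ j → a j ≡ a′ j) → (∀ j → b j ≡ b′ j) → a · b ≡ a′ · b′
  ·-cong a≗a′ b≗b′ = 𝔽.sum-cong-≗ (λ j → cong₂ _*F_ (a≗a′ j) (b≗b′ j))

  ·-zeroʳ : ∀ {m} (a b : Vector Carrier m) → IsZero b → a · b ≡ 0F
  ·-zeroʳ {m} a b b≈0 = trans (𝔽.sum-cong-≗ (λ j → trans (cong (a j *F_) (b≈0 j)) (zeroʳ (a j))))
                               (𝔽.sum-replicate-zero m)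

  ·-zeroˡ : ∀ {m} (a b : Vector Carrier m) → IsZero a → a · b ≡ 0F
  ·-zeroˡ {m} a b a≈0 = trans (𝔽.sum-cong-≗ (λ j → trans (cong (_*F b j) (a≈0 j)) (zeroˡ (b j))))
                               (𝔽.sum-replicate-zero m)

  ·-linearʳ : ∀ {m} (a x y : Vector Carrier m) α → a · (λ j → α *F x j +F y j) ≡ α *F (a · x) +F a · y
  ·-linearʳ a x y α = begin
    𝔽.sum (λ j → a j *F (α *F x j +F y j))
      ≡⟨ 𝔽.sum-cong-≗ (λ j → trans (distribˡ (a j) _ _)
                                     (cong (_+F a j *F y j) (x∙yz≈y∙xz (a j) α (x j)))) ⟩
    𝔽.sum (λ j → α *F (a j *F x j) +F a j *F y j)
      ≡⟨ 𝔽.∑-distrib-+ (λ j → α *F (a j *F x j)) (λ j → a j *F y j) ⟩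
    𝔽.sum (λ j → α *F (a j *F x j)) +F a · y
      ≡⟨ cong (_+F a · y) (𝔽.*-distribˡ-sum α (λ j → a j *F x j)) ⟨
    α *F (a · x) +F a · y ∎
    where open ≡-Reasoning

  ·-lincomb : ∀ {n} r (a : Vec n) c (u : Fin r → Vec n) → a · lincomb r c u ≡ c · (λ l → a · u l)
  ·-lincomb zero    a c u = ·-zeroʳ a _ (λ _ → refl)
  ·-lincomb (suc r) a c u = trans (·-linearʳ a (u Fin.zero) (lincomb r (c ∘ Fin.suc) (u ∘ Fin.suc)) (c Fin.zero))
                                  (cong (c Fin.zero *F a · u Fin.zero +F_) (·-lincomb r a (c ∘ Fin.suc) (u ∘ Fin.suc)))

  lincomb-cong : ∀ {n} r c {u u′ : Fin r → Vec n} → (∀ l j → u l j ≡ u′ l j) →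
                 ∀ j → lincomb r c u j ≡ lincomb r c u′ j
  lincomb-cong zero    c u≗u′ j = refl
  lincomb-cong (suc r) c u≗u′ j =
    cong₂ (λ s t → c Fin.zero *F s +F t) (u≗u′ Fin.zero j) (lincomb-cong r (c ∘ Fin.suc) (u≗u′ ∘ Fin.suc) j)

  lincomb-∘ : ∀ {n n′} r c (u : Fin r → Vec n) (p : Fin (suc n′) → Fin (suc n)) j →
              lincomb r c u (p j) ≡ lincomb r c (λ l → u l ∘ p) j
  lincomb-∘ zero    c u p j = refl
  lincomb-∘ (suc r) c u p j = cong (c Fin.zero *F u Fin.zero (p j) +F_) (lincomb-∘ r (c ∘ Fin.suc) (u ∘ Fin.suc) p j)

  ·-removeAt : ∀ {m} (a v : Vector Carrier (suc m)) i → a · v ≡ a i *F v i +F removeAt a i · removeAt v i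
  ·-removeAt a v i = 𝔽.sum-remove (λ j → a j *F v j)

  ·-insertAt : ∀ {m} (a : Vector Carrier (suc m)) i x c → a · insertAt x i c ≡ a i *F c +F removeAt a i · x
  ·-insertAt a i x c = trans (·-removeAt a (insertAt x i c) i)
    (cong₂ (λ s t → a i *F s +F t) (insertAt-lookup x i c) (·-cong (λ _ → refl) (insertAt-punchIn x i c)))

  sumF : (Carrier → ℕ) → ℕ
  sumF f = ∑[ k < q ] f (from k)

  sumF-cong : ∀ {f g : Carrier → ℕ} → (∀ c → f c ≡ g c) → sumF f ≡ sumF g
  sumF-cong f≗g = sum-cong-≗ (f≗g ∘ from)

  sumF-𝟙-≟ : ∀ c₀ → sumF (λ c → 𝟙 (c ≟F c₀)) ≡ 1
  sumF-𝟙-≟ c₀ = trans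
    (sum-cong-≗ (λ k → 𝟙-cong (λ e → sym (inverseˡ (sym e))) inverseʳ (from k ≟F c₀) (k ≟ to c₀)))
    (sum-𝟙-≟ (to c₀))

  sumV : ∀ m → (Vector Carrier m → ℕ) → ℕ
  sumV zero    f = f []ᵥ
  sumV (suc m) f = sumF λ c → sumV m (λ x → f (c ∷ᵥ x))

  sumV-cong : ∀ m {f g : Vector Carrier m → ℕ} → (∀ x → f x ≡ g x) → sumV m f ≡ sumV m g
  sumV-cong zero    f≗g = f≗g []ᵥ
  sumV-cong (suc m) f≗g = sumF-cong (λ c → sumV-cong m (λ x → f≗g (c ∷ᵥ x)))

  sumV-distrib-+ : ∀ m (f g : Vector Carrier m → ℕ) → sumV m (λ x → f x + g x) ≡ sumV m f + sumV m g
  sumV-distrib-+ zero    f g = refl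
  sumV-distrib-+ (suc m) f g = trans
    (sum-cong-≗ (λ k → sumV-distrib-+ m (f ∘ (from k ∷ᵥ_)) (g ∘ (from k ∷ᵥ_))))
    (∑-distrib-+ (λ k → sumV m (f ∘ (from k ∷ᵥ_))) (λ k → sumV m (g ∘ (from k ∷ᵥ_))))

  *-distribˡ-sumV : ∀ m k (f : Vector Carrier m → ℕ) → k * sumV m f ≡ sumV m (λ x → k * f x)
  *-distribˡ-sumV zero    k f = refl
  *-distribˡ-sumV (suc m) k f = trans (*-distribˡ-sum k (λ i → sumV m (f ∘ (from i ∷ᵥ_))))
                                      (sum-cong-≗ (λ i → *-distribˡ-sumV m k (f ∘ (from i ∷ᵥ_))))

  sumV-const : ∀ m k → sumV m (λ _ → k) ≡ q ^ m * k
  sumV-const zero    k = sym (ℕP.+-identityʳ k)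
  sumV-const (suc m) k = begin
    ∑[ i < q ] sumV m (λ _ → k)  ≡⟨ cong (λ t → ∑[ i < q ] t) (sumV-const m k) ⟩
    ∑[ i < q ] (q ^ m * k)       ≡⟨ sum-const q (q ^ m * k) ⟩
    q * (q ^ m * k)              ≡⟨ ℕP.*-assoc q (q ^ m) k ⟨
    q * q ^ m * k                ∎
    where open ≡-Reasoning

  sumV-mono-≤ : ∀ m {f g : Vector Carrier m → ℕ} → (∀ x → f x ≤ g x) → sumV m f ≤ sumV m g
  sumV-mono-≤ zero    f≤g = f≤g []ᵥ
  sumV-mono-≤ (suc m) f≤g = sum-mono-≤ (λ i → sumV-mono-≤ m (λ x → f≤g (from i ∷ᵥ x)))

  sumV-comm-sum : ∀ m n (f : Vector Carrier m → Fin n → ℕ) →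
                  sumV m (λ x → ∑[ j < n ] f x j) ≡ ∑[ j < n ] sumV m (λ x → f x j)
  sumV-comm-sum zero    n f = refl
  sumV-comm-sum (suc m) n f = trans (sum-cong-≗ (λ i → sumV-comm-sum m n (f ∘ (from i ∷ᵥ_))))
                                    (∑-comm (λ i j → sumV m (λ x → f (from i ∷ᵥ x) j)))

  sumV-comm : ∀ m m′ (f : Vector Carrier m → Vector Carrier m′ → ℕ) →
              sumV m (λ x → sumV m′ (f x)) ≡ sumV m′ (λ y → sumV m (λ x → f x y))
  sumV-comm zero    m′ f = refl
  sumV-comm (suc m) m′ f = trans (sum-cong-≗ (λ i → sumV-comm m m′ (f ∘ (from i ∷ᵥ_))))
                                 (sym (sumV-comm-sum m′ q (λ y i → sumV m (λ x → f (from i ∷ᵥ x) y))))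

  sumV-affine : ∀ m (f h : Vector Carrier m → ℕ) k c k′ → (∀ x → f x + k * h x ≡ c + k′ * h x) →
                sumV m f + k * sumV m h ≡ q ^ m * c + k′ * sumV m h
  sumV-affine m f h k c k′ fibre = begin
    sumV m f + k * sumV m h                ≡⟨ cong (sumV m f +_) (*-distribˡ-sumV m k h) ⟩
    sumV m f + sumV m (λ x → k * h x)      ≡⟨ sumV-distrib-+ m f (λ x → k * h x) ⟨
    sumV m (λ x → f x + k * h x)           ≡⟨ sumV-cong m fibre ⟩
    sumV m (λ x → c + k′ * h x)            ≡⟨ sumV-distrib-+ m (λ _ → c) (λ x → k′ * h x) ⟩
    sumV m (λ _ → c) + sumV m (λ x → k′ * h x)  ≡⟨ cong₂ _+_ (sumV-const m c) (sym (*-distribˡ-sumV m k′ h)) ⟩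
    q ^ m * c + k′ * sumV m h              ∎
    where open ≡-Reasoning

  𝟙-isZero?-∷ : ∀ {m} c (x : Vector Carrier m) → 𝟙 (isZero? (c ∷ᵥ x)) ≡ 𝟙 (c ≟F 0F) * 𝟙 (isZero? x)
  𝟙-isZero?-∷ c x = trans
    (𝟙-cong (λ c∷x≈0 → c∷x≈0 Fin.zero , c∷x≈0 ∘ Fin.suc)
            (λ { (c≡0 , x≈0) Fin.zero → c≡0 ; (c≡0 , x≈0) (Fin.suc j) → x≈0 j })
            (isZero? (c ∷ᵥ x)) (c ≟F 0F ×-dec isZero? x))
    (𝟙-×-dec (c ≟F 0F) (isZero? x))

  count-zero : ∀ m → sumV m (λ x → 𝟙 (isZero? x)) ≡ 1
  count-zero zero    = 𝟙-yes (λ ()) (isZero? []ᵥ)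
  count-zero (suc m) = begin
    sumF (λ c → sumV m (λ x → 𝟙 (isZero? (c ∷ᵥ x))))
      ≡⟨ sumF-cong (λ c → sumV-cong m (𝟙-isZero?-∷ c)) ⟩
    sumF (λ c → sumV m (λ x → 𝟙 (c ≟F 0F) * 𝟙 (isZero? x)))
      ≡⟨ sumF-cong (λ c → *-distribˡ-sumV m (𝟙 (c ≟F 0F)) (λ x → 𝟙 (isZero? x))) ⟨
    sumF (λ c → 𝟙 (c ≟F 0F) * sumV m (λ x → 𝟙 (isZero? x)))
      ≡⟨ sumF-cong (λ c → cong (𝟙 (c ≟F 0F) *_) (count-zero m)) ⟩
    sumF (λ c → 𝟙 (c ≟F 0F) * 1)
      ≡⟨ sumF-cong (λ c → ℕP.*-identityʳ (𝟙 (c ≟F 0F))) ⟩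
    sumF (λ c → 𝟙 (c ≟F 0F))
      ≡⟨ sumF-𝟙-≟ 0F ⟩
    1 ∎
    where open ≡-Reasoning

  nonzero : ∀ {m} → Vector Carrier m → ℕ
  nonzero x = 𝟙 (¬? (isZero? x))

  sumV-nonzero-+1 : ∀ m (f : Vector Carrier m → ℕ) → (∀ x → IsZero x → f x ≡ 1) →
                    sumV m (λ x → nonzero x * f x) + 1 ≡ sumV m f
  sumV-nonzero-+1 m f f[0]≡1 = begin
    sumV m (λ x → nonzero x * f x) + 1
      ≡⟨ cong (sumV m (λ x → nonzero x * f x) +_) (count-zero m) ⟨
    sumV m (λ x → nonzero x * f x) + sumV m (λ x → 𝟙 (isZero? x))
      ≡⟨ sumV-distrib-+ m (λ x → nonzero x * f x) (λ x → 𝟙 (isZero? x)) ⟨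
    sumV m (λ x → nonzero x * f x + 𝟙 (isZero? x))
      ≡⟨ sumV-cong m (λ x → split x (isZero? x)) ⟩
    sumV m f ∎
    where
    open ≡-Reasoning
    split : ∀ x (d : Dec (IsZero x)) → 𝟙 (¬? d) * f x + 𝟙 d ≡ f x
    split x (yes x≈0) = sym (f[0]≡1 x x≈0)
    split x (no _)    = trans (ℕP.+-identityʳ (1 * f x)) (ℕP.*-identityˡ (f x))

  count-nonzero : ∀ m → sumV m nonzero + 1 ≡ q ^ m
  count-nonzero m = begin
    sumV m nonzero + 1                ≡⟨ cong (_+ 1) (sumV-cong m (λ x → ℕP.*-identityʳ (nonzero x))) ⟨
    sumV m (λ x → nonzero x * 1) + 1  ≡⟨ sumV-nonzero-+1 m (λ _ → 1) (λ _ _ → refl) ⟩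
    sumV m (λ _ → 1)                  ≡⟨ sumV-const m 1 ⟩
    q ^ m * 1                         ≡⟨ ℕP.*-identityʳ (q ^ m) ⟩
    q ^ m                             ∎
    where open ≡-Reasoning

  +-≡⇒≡-+ : ∀ x y t → x +F y ≡ t → y ≡ -F x +F t
  +-≡⇒≡-+ x y t x+y≡t = trans (sym (\\-leftDividesʳ x y)) (cong (-F x +F_) x+y≡t)

  ≡-+⇒+-≡ : ∀ x y t → y ≡ -F x +F t → x +F y ≡ t
  ≡-+⇒+-≡ x y t y≡-x+t = trans (cong (x +F_) y≡-x+t) (\\-leftDividesˡ x t)

  module _ {w : Carrier} (w≢0 : w ≢ 0F) where

    private
      w⁻¹ : Carrier
      w⁻¹ = proj₁ (inverse w w≢0)

      *w*w⁻¹ : ∀ x → x *F w *F w⁻¹ ≡ x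
      *w*w⁻¹ x = trans (*-assoc x w w⁻¹) (trans (cong (x *F_) (proj₂ (inverse w w≢0))) (*-identityʳ x))

      *w⁻¹*w : ∀ x → x *F w⁻¹ *F w ≡ x
      *w⁻¹*w x = trans (*-assoc x w⁻¹ w)
        (trans (cong (x *F_) (trans (*-comm w⁻¹ w) (proj₂ (inverse w w≢0)))) (*-identityʳ x))

    sumF-𝟙-*≟ : ∀ t → sumF (λ c → 𝟙 (c *F w ≟F t)) ≡ 1
    sumF-𝟙-*≟ t = trans
      (sumF-cong (λ c → 𝟙-cong (λ cw≡t → trans (sym (*w*w⁻¹ c)) (cong (_*F w⁻¹) cw≡t))
                              (λ c≡t/w → trans (cong (_*F w) c≡t/w) (*w⁻¹*w t))
                              (c *F w ≟F t) (c ≟F t *F w⁻¹)))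
      (sumF-𝟙-≟ (t *F w⁻¹))

  count-·≟-tail-zero : ∀ m (w : Vector Carrier (suc m)) → w Fin.zero ≢ 0F → IsZero (tail w) →
                       ∀ t → sumV (suc m) (λ x → 𝟙 (x · w ≟F t)) ≡ q ^ m
  count-·≟-tail-zero m w w₀≢0 w′≈0 t = begin
    sumF (λ c → sumV m (λ x → 𝟙 (c *F w₀ +F x · tail w ≟F t)))
      ≡⟨ sumF-cong (λ c → sumV-cong m (λ x → cong (λ s → 𝟙 (s ≟F t)) (drop-tail c x))) ⟩
    sumF (λ c → sumV m (λ _ → 𝟙 (c *F w₀ ≟F t)))
      ≡⟨ sumF-cong (λ c → sumV-const m (𝟙 (c *F w₀ ≟F t))) ⟩
    sumF (λ c → q ^ m * 𝟙 (c *F w₀ ≟F t))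
      ≡⟨ *-distribˡ-sum (q ^ m) (λ k → 𝟙 (from k *F w₀ ≟F t)) ⟨
    q ^ m * sumF (λ c → 𝟙 (c *F w₀ ≟F t))
      ≡⟨ cong (q ^ m *_) (sumF-𝟙-*≟ w₀≢0 t) ⟩
    q ^ m * 1
      ≡⟨ ℕP.*-identityʳ (q ^ m) ⟩
    q ^ m ∎
    where
    open ≡-Reasoning
    w₀ = w Fin.zero
    drop-tail : ∀ c x → c *F w₀ +F x · tail w ≡ c *F w₀
    drop-tail c x = trans (cong (c *F w₀ +F_) (·-zeroʳ x (tail w) w′≈0)) (+-identityʳ (c *F w₀))

  count-·≟ : ∀ m (w : Vector Carrier (suc m)) → ¬ IsZero w →
             ∀ t → sumV (suc m) (λ x → 𝟙 (x · w ≟F t)) ≡ q ^ m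
  count-·≟ m w w≉0 t with isZero? (tail w)
  ... | yes w′≈0 =
    count-·≟-tail-zero m w (λ w₀≡0 → w≉0 λ { Fin.zero → w₀≡0 ; (Fin.suc j) → w′≈0 j }) w′≈0 t
  count-·≟ zero    w w≉0 t | no w′≉0 = contradiction (λ ()) w′≉0
  count-·≟ (suc m) w w≉0 t | no w′≉0 = begin
    sumF (λ c → sumV (suc m) (λ x → 𝟙 (c *F w₀ +F x · tail w ≟F t)))
      ≡⟨ sumF-cong (λ c → sumV-cong (suc m) (λ x → shift c x)) ⟩
    sumF (λ c → sumV (suc m) (λ x → 𝟙 (x · tail w ≟F -F (c *F w₀) +F t)))
      ≡⟨ sumF-cong (λ c → count-·≟ m (tail w) w′≉0 (-F (c *F w₀) +F t)) ⟩
    sumF (λ _ → q ^ m)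
      ≡⟨ sum-const q (q ^ m) ⟩
    q ^ suc m ∎
    where
    open ≡-Reasoning
    w₀ = w Fin.zero
    shift : ∀ c x → 𝟙 (c *F w₀ +F x · tail w ≟F t) ≡ 𝟙 (x · tail w ≟F -F (c *F w₀) +F t)
    shift c x = 𝟙-cong (+-≡⇒≡-+ _ _ t) (≡-+⇒+-≡ _ _ t)
                       (c *F w₀ +F x · tail w ≟F t) (x · tail w ≟F -F (c *F w₀) +F t)

  -- The vectors a ⊥ u₀, u₁ are counted through the pairs (c , a) ∈ F² × F^(e+2) with
  -- c₀ (a · u₀) + c₁ (a · u₁) = 0, counted once by c and once by a.
  module PairCount {e} (u : Fin 2 → Vec (suc e)) where
    D : ℕ
    D = suc (suc e)

    s : Vector Carrier D → Vector Carrier 2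
    s a l = a · u l

    pairs : ℕ
    pairs = sumV 2 (λ c → sumV D (λ a → 𝟙 (c · s a ≟F 0F)))

    z : Vector Carrier 2 → ℕ
    z c = 𝟙 (isZero? c)

    zeros : ℕ
    zeros = sumV D (z ∘ s)

    pairs-by-first : LinIndep 2 u → pairs + q ^ suc e ≡ q ^ 2 * q ^ suc e + q * q ^ suc e
    pairs-by-first indep = begin
      pairs + K                     ≡⟨ cong (λ t → pairs + t) (ℕP.*-identityʳ K) ⟨
      pairs + K * 1                 ≡⟨ cong (λ t → pairs + K * t) (count-zero 2) ⟨
      pairs + K * sumV 2 z          ≡⟨ sumV-affine 2 inner z K K (q * K) (λ c → fibre c (isZero? c)) ⟩
      q ^ 2 * K + q * K * sumV 2 z  ≡⟨ cong (λ t → q ^ 2 * K + q * K * t) (count-zero 2) ⟩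
      q ^ 2 * K + q * K * 1         ≡⟨ cong (q ^ 2 * K +_) (ℕP.*-identityʳ (q * K)) ⟩
      q ^ 2 * K + q * K             ∎
      where
      open ≡-Reasoning
      K = q ^ suc e
      inner : Vector Carrier 2 → ℕ
      inner c = sumV D (λ a → 𝟙 (c · s a ≟F 0F))
      fibre : ∀ c (d : Dec (IsZero c)) → inner c + K * 𝟙 d ≡ K + q * K * 𝟙 d
      fibre c (yes c≈0) = begin
        inner c + K * 1
          ≡⟨ cong (_+ K * 1) (sumV-cong D (λ a → 𝟙-yes (·-zeroˡ c (s a) c≈0) (c · s a ≟F 0F))) ⟩
        sumV D (λ _ → 1) + K * 1
          ≡⟨ cong₂ _+_ (sumV-const D 1) (ℕP.*-identityʳ K) ⟩
        q * K * 1 + K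
          ≡⟨ ℕP.+-comm (q * K * 1) K ⟩
        K + q * K * 1 ∎
      fibre c (no c≉0) = begin
        inner c + K * 0
          ≡⟨ cong₂ _+_ (sumV-cong D (λ a → cong (λ t → 𝟙 (t ≟F 0F)) (·-lincomb 2 a c u)))
                       (sym (ℕP.*-zeroʳ K)) ⟨
        sumV D (λ a → 𝟙 (a · lincomb 2 c u ≟F 0F)) + 0
          ≡⟨ cong (_+ 0) (count-·≟ (suc e) (lincomb 2 c u) (λ v≈0 → c≉0 (indep c v≈0)) 0F) ⟩
        K + 0
          ≡⟨ cong (K +_) (ℕP.*-zeroʳ (q * K)) ⟨
        K + q * K * 0 ∎

    pairs-by-second : pairs + q * zeros ≡ q * q ^ suc e * q + q ^ 2 * zeros
    pairs-by-second = begin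
      pairs + q * zeros                   ≡⟨ cong (_+ q * zeros) (sumV-comm 2 D (λ c a → 𝟙 (c · s a ≟F 0F))) ⟩
      sumV D inner + q * zeros            ≡⟨ sumV-affine D inner (z ∘ s) q q (q ^ 2) (λ a → fibre a (isZero? (s a))) ⟩
      q * q ^ suc e * q + q ^ 2 * zeros   ∎
      where
      open ≡-Reasoning
      inner : Vector Carrier D → ℕ
      inner a = sumV 2 (λ c → 𝟙 (c · s a ≟F 0F))
      fibre : ∀ a (d : Dec (IsZero (s a))) → inner a + q * 𝟙 d ≡ q + q ^ 2 * 𝟙 d
      fibre a (yes sa≈0) = begin
        inner a + q * 1
          ≡⟨ cong (_+ q * 1) (sumV-cong 2 (λ c → 𝟙-yes (·-zeroʳ c (s a) sa≈0) (c · s a ≟F 0F))) ⟩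
        sumV 2 (λ _ → 1) + q * 1
          ≡⟨ cong₂ _+_ (sumV-const 2 1) (ℕP.*-identityʳ q) ⟩
        q ^ 2 * 1 + q
          ≡⟨ ℕP.+-comm (q ^ 2 * 1) q ⟩
        q + q ^ 2 * 1 ∎
      fibre a (no sa≉0) = begin
        inner a + q * 0           ≡⟨ cong₂ _+_ (count-·≟ 1 (s a) sa≉0 0F) (ℕP.*-zeroʳ q) ⟩
        q * 1 + 0                 ≡⟨ cong₂ _+_ (ℕP.*-identityʳ q) (sym (ℕP.*-zeroʳ (q ^ 2))) ⟩
        q + q ^ 2 * 0             ∎

  count-⊥-pair : ∀ e (u : Fin 2 → Vec (suc e)) → LinIndep 2 u →
                 sumV (suc (suc e)) (λ a → 𝟙 (isZero? (λ l → a · u l))) ≡ q ^ e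
  count-⊥-pair e u indep = ℕP.*-cancelˡ-≡ zeros (q ^ e) q
    (sym (double-count q pairs (q ^ suc e) zeros q≥2 (pairs-by-first indep) pairs-by-second))
    where open PairCount u

  _⊥_ : ∀ {n k} → Vec n → Subspace n k → Set
  a ⊥ U = ∀ l → a · Subspace.basis U l ≡ 0F

  _⊥?_ : ∀ {n k} (a : Vec n) (U : Subspace n k) → Dec (a ⊥ U)
  a ⊥? U = isZero? (λ l → a · Subspace.basis U l)

  hits : ∀ {n} → Vec n → List (Line n) → ℕ
  hits a B = ∑[ j < length B ] 𝟙 (a ⊥? lookup B j)

  ⊥-lincomb : ∀ {n} (a : Vec n) r c (u : Fin r → Vec n) → (∀ l → a · u l ≡ 0F) → a · lincomb r c u ≡ 0F
  ⊥-lincomb a r c u a⊥u = trans (·-lincomb r a c u) (·-zeroʳ c _ a⊥u)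

  count-nonzero-⊥ : ∀ {n} (l : Line (suc n)) → sumV (suc (suc n)) (λ a → nonzero a * 𝟙 (a ⊥? l)) + 1 ≡ q ^ n
  count-nonzero-⊥ {n} l = trans
    (sumV-nonzero-+1 (suc (suc n)) (λ a → 𝟙 (a ⊥? l))
                     (λ a a≈0 → 𝟙-yes (λ m → ·-zeroˡ a (Subspace.basis l m) a≈0) (a ⊥? l)))
    (count-⊥-pair n (Subspace.basis l) (Subspace.indep l))

  -- a^⊥ is identified with F^(n+1) by forgetting the i-th coordinate, which lift recovers by
  -- solving a · v = 0 for it.
  module Hyperplane {n} (a : Vec (suc n)) (i : Fin (suc (suc n))) (aᵢ≢0 : a i ≢ 0F) where

    private
      aᵢ⁻¹ : Carrier
      aᵢ⁻¹ = proj₁ (inverse (a i) aᵢ≢0)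

      aᵢaᵢ⁻¹≡1 : a i *F aᵢ⁻¹ ≡ 1F
      aᵢaᵢ⁻¹≡1 = proj₂ (inverse (a i) aᵢ≢0)

      a′ : Vec n
      a′ = removeAt a i

    lift : Vec n → Vec (suc n)
    lift x = insertAt x i (-F (a′ · x) *F aᵢ⁻¹)

    lower : Vec (suc n) → Vec n
    lower v = removeAt v i

    a·lift : ∀ x → a · lift x ≡ 0F
    a·lift x = begin
      a · lift x                        ≡⟨ ·-insertAt a i x (-F a′x *F aᵢ⁻¹) ⟩
      a i *F (-F a′x *F aᵢ⁻¹) +F a′x    ≡⟨ cong (_+F a′x) (x∙yz≈y∙xz (a i) (-F a′x) aᵢ⁻¹) ⟩
      -F a′x *F (a i *F aᵢ⁻¹) +F a′x    ≡⟨ cong (λ t → -F a′x *F t +F a′x) aᵢaᵢ⁻¹≡1 ⟩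
      -F a′x *F 1F +F a′x               ≡⟨ cong (_+F a′x) (*-identityʳ (-F a′x)) ⟩
      -F a′x +F a′x                     ≡⟨ -‿inverseˡ a′x ⟩
      0F                                ∎
      where
      open ≡-Reasoning
      a′x = a′ · x

    lower-lift : ∀ x j → lower (lift x) j ≡ x j
    lower-lift x = insertAt-punchIn x i _

    lift-lower : ∀ v → a · v ≡ 0F → ∀ j → lift (lower v) j ≡ v j
    lift-lower v a·v≡0 j = trans (cong (λ c → insertAt (lower v) i c j) solved) (insertAt-removeAt v i j)
      where
      open ≡-Reasoning
      a′v≡- : a′ · lower v ≡ -F (a i *F v i)
      a′v≡- = +-inverseʳ-unique (a i *F v i) _ (trans (sym (·-removeAt a v i)) a·v≡0)
      solved : -F (a′ · lower v) *F aᵢ⁻¹ ≡ v i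
      solved = begin
        -F (a′ · lower v) *F aᵢ⁻¹        ≡⟨ cong (λ t → -F t *F aᵢ⁻¹) a′v≡- ⟩
        -F (-F (a i *F v i)) *F aᵢ⁻¹     ≡⟨ cong (_*F aᵢ⁻¹) (-‿involutive (a i *F v i)) ⟩
        a i *F v i *F aᵢ⁻¹               ≡⟨ cong (_*F aᵢ⁻¹) (*-comm (a i) (v i)) ⟩
        v i *F a i *F aᵢ⁻¹               ≡⟨ *-assoc (v i) (a i) aᵢ⁻¹ ⟩
        v i *F (a i *F aᵢ⁻¹)             ≡⟨ cong (v i *F_) aᵢaᵢ⁻¹≡1 ⟩
        v i *F 1F                        ≡⟨ *-identityʳ (v i) ⟩
        v i                              ∎

    lift-cong : ∀ {x y} → (∀ j → x j ≡ y j) → ∀ j → lift x j ≡ lift y j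
    lift-cong {x} {y} x≗y j =
      trans (cong (λ c → insertAt x i c j) (cong (λ t → -F t *F aᵢ⁻¹) (·-cong {a = a′} (λ _ → refl) x≗y)))
            (insertAt-cong x≗y i (-F (a′ · y) *F aᵢ⁻¹) j)

    lower-injective : ∀ {u v} → a · u ≡ 0F → a · v ≡ 0F →
                      (∀ j → lower u j ≡ lower v j) → ∀ j → u j ≡ v j
    lower-injective {u} {v} a·u≡0 a·v≡0 lu≗lv j = begin
      u j                 ≡⟨ lift-lower u a·u≡0 j ⟨
      lift (lower u) j    ≡⟨ lift-cong lu≗lv j ⟩
      lift (lower v) j    ≡⟨ lift-lower v a·v≡0 j ⟩
      v j                 ∎
      where open ≡-Reasoning

    lower-lincomb : ∀ r c (u : Fin r → Vec (suc n)) j → lower (lincomb r c u) j ≡ lincomb r c (lower ∘ u) j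
    lower-lincomb r c u = lincomb-∘ r c u (punchIn i)

    liftS : ∀ {k} → Subspace n k → Subspace (suc n) k
    liftS {k} (subspace b indep) = subspace (lift ∘ b) λ c lincomb≈0 → indep c λ j → begin
      lincomb k c b j                      ≡⟨ lincomb-cong k c (λ l → lower-lift (b l)) j ⟨
      lincomb k c (lower ∘ lift ∘ b) j     ≡⟨ lower-lincomb k c (lift ∘ b) j ⟨
      lincomb k c (lift ∘ b) (punchIn i j) ≡⟨ lincomb≈0 (punchIn i j) ⟩
      0F                                   ∎
      where open ≡-Reasoning

    lowerS : ∀ {k} (U : Subspace (suc n) k) → a ⊥ U → Subspace n k
    lowerS {k} (subspace b indep) a⊥U = subspace (lower ∘ b) λ c lincomb≈0 → indep c
      (lower-injective (⊥-lincomb a k c b a⊥U) (·-zeroʳ a zeroV (λ _ → refl))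
                       (λ j → trans (lower-lincomb k c b j) (lincomb≈0 j)))

    ⊆-liftS⇒⊥ : ∀ {k k′} (U : Subspace (suc n) k) (P : Subspace n k′) → U ⊆ liftS P → a ⊥ U
    ⊆-liftS⇒⊥ {k′ = k′} U P U⊆P l = let (c , u≈) = U⊆P l in
      trans (·-cong {a = a} (λ _ → refl) u≈)
            (⊥-lincomb a k′ c (lift ∘ Subspace.basis P) (a·lift ∘ Subspace.basis P))

    ⊆-liftS⇒lowerS-⊆ : ∀ {k k′} (U : Subspace (suc n) k) (P : Subspace n k′) (a⊥U : a ⊥ U) →
                       U ⊆ liftS P → lowerS U a⊥U ⊆ P
    ⊆-liftS⇒lowerS-⊆ {k′ = k′} U P a⊥U U⊆P l = let (c , u≈) = U⊆P l in c , λ j →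
      trans (u≈ (punchIn i j)) (trans (lower-lincomb k′ c (lift ∘ Subspace.basis P) j)
                                      (lincomb-cong k′ c (λ m → lower-lift (Subspace.basis P m)) j))

    lowerS-⊆-reflects : ∀ {k k′} (U : Subspace (suc n) k) (V : Subspace (suc n) k′)
                        (a⊥U : a ⊥ U) (a⊥V : a ⊥ V) →
                        lowerS U a⊥U ⊆ lowerS V a⊥V → U ⊆ V
    lowerS-⊆-reflects {k′ = k′} U V a⊥U a⊥V U⊆V l = let (c , u≈) = U⊆V l in c ,
      lower-injective (a⊥U l) (⊥-lincomb a k′ c (Subspace.basis V) a⊥V)
                      (λ j → trans (u≈ j) (sym (lower-lincomb k′ c (Subspace.basis V) j)))

    keep : (l : Line (suc n)) → Dec (a ⊥ l) → List (Line n) → List (Line n)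
    keep l (yes a⊥l) R = lowerS l a⊥l ∷ R
    keep l (no _)    R = R

    restrict : List (Line (suc n)) → List (Line n)
    restrict []      = []
    restrict (l ∷ B) = keep l (a ⊥? l) (restrict B)

    length-restrict : ∀ B → length (restrict B) ≡ hits a B
    length-restrict []      = refl
    length-restrict (l ∷ B) = go (a ⊥? l)
      where
      go : (d : Dec (a ⊥ l)) → length (keep l d (restrict B)) ≡ 𝟙 d + hits a B
      go (yes _) = cong suc (length-restrict B)
      go (no  _) = length-restrict B

    restrict-All : ∀ {P : Line n → Set} {Q : Line (suc n) → Set} → (∀ l a⊥l → Q l → P (lowerS l a⊥l)) →
                   ∀ {B} → All Q B → All P (restrict B)
    restrict-All         f {[]}    []        = []
    restrict-All {P} {Q} f {l ∷ B} (Ql ∷ QB) = go (a ⊥? l)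
      where
      go : (d : Dec (a ⊥ l)) → All P (keep l d (restrict B))
      go (yes a⊥l) = f l a⊥l Ql ∷ restrict-All f QB
      go (no  _)   = restrict-All f QB

    restrict-distinct : ∀ {B} → AllPairs (λ l m → ¬ l ≐ m) B → AllPairs (λ l m → ¬ l ≐ m) (restrict B)
    restrict-distinct {[]}    []                 = []
    restrict-distinct {l ∷ B} (l≉B ∷ B-distinct) = go (a ⊥? l)
      where
      go : (d : Dec (a ⊥ l)) → AllPairs (λ l m → ¬ l ≐ m) (keep l d (restrict B))
      go (yes a⊥l) = restrict-All (λ m a⊥m l≉m (l⊆m , m⊆l) → l≉m (lowerS-⊆-reflects l m a⊥l a⊥m l⊆m ,
                                                                  lowerS-⊆-reflects m l a⊥m a⊥l m⊆l)) l≉B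
                     ∷ restrict-distinct B-distinct
      go (no  _)   = restrict-distinct B-distinct

    restrict-blocks : ∀ (π : Plane n) {B} → Any (λ l → l ⊆ liftS π) B → Any (λ l → l ⊆ π) (restrict B)
    restrict-blocks π {l ∷ B} (here l⊆π) = go (a ⊥? l)
      where
      go : (d : Dec (a ⊥ l)) → Any (λ l → l ⊆ π) (keep l d (restrict B))
      go (yes a⊥l) = here (⊆-liftS⇒lowerS-⊆ l π a⊥l l⊆π)
      go (no  a⊥̸l) = contradiction (⊆-liftS⇒⊥ l π l⊆π) a⊥̸l
    restrict-blocks π {l ∷ B} (there B-blocks) = go (a ⊥? l)
      where
      go : (d : Dec (a ⊥ l)) → Any (λ l → l ⊆ π) (keep l d (restrict B))
      go (yes _) = there (restrict-blocks π B-blocks)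
      go (no  _) = restrict-blocks π B-blocks

    restrict-isBlockingSet : ∀ B → IsBlockingSet (suc n) B → IsBlockingSet n (restrict B)
    restrict-isBlockingSet B (distinct , blocks) =
      restrict-distinct distinct , λ π → restrict-blocks π (blocks (liftS π))

  restriction-average : ∀ {n} b y (B : List (Line (suc n))) → IsBlockingSet (suc n) B →
                        (∀ B′ → IsBlockingSet n B′ → b ≤ y * length B′) →
                        b * (q ^ suc (suc n) ∸ 1) ≤ y * (length B * (q ^ n ∸ 1))
  restriction-average {n} b y B isB bound = begin
    b * (q ^ D ∸ 1)                       ≡⟨ cong (b *_) nonzeros ⟨
    b * sumV D nonzero                         ≡⟨ *-distribˡ-sumV D b nonzero ⟩
    sumV D (λ a → b * nonzero a)               ≤⟨ sumV-mono-≤ D (λ a → fibre a (isZero? a)) ⟩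
    sumV D (λ a → y * (nonzero a * hits a B))  ≡⟨ *-distribˡ-sumV D y (λ a → nonzero a * hits a B) ⟨
    y * sumV D (λ a → nonzero a * hits a B)    ≡⟨ cong (y *_) incidences ⟩
    y * (length B * (q ^ n ∸ 1))          ∎
    where
    open ℕP.≤-Reasoning
    D = suc (suc n)
    nonzeros : sumV D nonzero ≡ q ^ D ∸ 1
    nonzeros = +1≡⇒≡∸1 (count-nonzero D)
    incidences : sumV D (λ a → nonzero a * hits a B) ≡ length B * (q ^ n ∸ 1)
    incidences = begin-equality
      sumV D (λ a → nonzero a * hits a B)
        ≡⟨ sumV-cong D (λ a → *-distribˡ-sum (nonzero a) (λ j → 𝟙 (a ⊥? lookup B j))) ⟩
      sumV D (λ a → ∑[ j < length B ] (nonzero a * 𝟙 (a ⊥? lookup B j)))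
        ≡⟨ sumV-comm-sum D (length B) (λ a j → nonzero a * 𝟙 (a ⊥? lookup B j)) ⟩
      (∑[ j < length B ] sumV D (λ a → nonzero a * 𝟙 (a ⊥? lookup B j)))
        ≡⟨ sum-cong-≗ (λ j → +1≡⇒≡∸1 (count-nonzero-⊥ (lookup B j))) ⟩
      (∑[ j < length B ] (q ^ n ∸ 1))
        ≡⟨ sum-const (length B) (q ^ n ∸ 1) ⟩
      length B * (q ^ n ∸ 1) ∎
    fibre : ∀ a (d : Dec (IsZero a)) → b * 𝟙 (¬? d) ≤ y * (𝟙 (¬? d) * hits a B)
    fibre a (yes _)   = ℕP.≤-reflexive (trans (ℕP.*-zeroʳ b) (sym (ℕP.*-zeroʳ y)))
    fibre a (no a≉0) = begin
      b * 1                   ≡⟨ ℕP.*-identityʳ b ⟩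
      b                       ≤⟨ bound (restrict B) (restrict-isBlockingSet B isB) ⟩
      y * length (restrict B) ≡⟨ cong (y *_) (trans (length-restrict B) (sym (ℕP.*-identityˡ (hits a B)))) ⟩
      y * (1 * hits a B)      ∎
      where
      nonzero-entry = FinP.¬∀⟶∃¬ D (λ j → a j ≡ 0F) (λ j → a j ≟F 0F) a≉0
      open Hyperplane a (proj₁ nonzero-entry) (proj₂ nonzero-entry)

  ^∸1-nonZero : ∀ m → NonZero (q ^ suc m ∸ 1)
  ^∸1-nonZero m = >-nonZero (ℕP.m<n⇒0<n∸m (ℕP.^-monoʳ-< q q≥2 {0} {suc m} (s≤s z≤n)))

  numLines≡lineCount : ∀ m → numLines m ≡ lineCount q m
  numLines≡lineCount m = begin
    ((q ^ suc m ∸ 1) * (q ^ m ∸ 1)) DivMod./ den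
      ≡⟨ DivMod./-congˡ ([^suc∸1]*[^∸1]≡lineCount*[[^2∸1]*[∸1]] q m) ⟩
    (lineCount q m * den) DivMod./ den
      ≡⟨ DivMod.m*n/n≡m (lineCount q m) den ⟩
    lineCount q m ∎
    where
    open ≡-Reasoning
    den = (q ^ 2 ∸ 1) * (q ∸ 1)
    instance
      den-nonZero : NonZero den
      den-nonZero = ℕP.m*n≢0 (q ^ 2 ∸ 1) (q ∸ 1) {{^∸1-nonZero 1}} {{>-nonZero (ℕP.m<n⇒0<n∸m q≥2)}}

  numLines-nonZero : ∀ m → NonZero (numLines (suc m))
  numLines-nonZero m = subst NonZero (sym (numLines≡lineCount (suc m))) _

  numLines-suc-ratio : ∀ n → numLines (suc n) * (q ^ n ∸ 1) ≡ numLines n * (q ^ suc (suc n) ∸ 1)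
  numLines-suc-ratio n = begin
    numLines (suc n) * (q ^ n ∸ 1)         ≡⟨ cong (_* (q ^ n ∸ 1)) (numLines≡lineCount (suc n)) ⟩
    lineCount q (suc n) * (q ^ n ∸ 1)       ≡⟨ lineCount-suc-ratio q n ⟩
    lineCount q n * (q ^ suc (suc n) ∸ 1)   ≡⟨ cong (_* (q ^ suc (suc n) ∸ 1)) (numLines≡lineCount n) ⟨
    numLines n * (q ^ suc (suc n) ∸ 1)      ∎
    where open ≡-Reasoning

  density-bound-suc : ∀ {n} b y → 1 ≤ n →
                      (∀ B′ → IsBlockingSet n B′ → b * numLines n ≤ y * length B′) →
                      ∀ B → IsBlockingSet (suc n) B → b * numLines (suc n) ≤ y * length B
  density-bound-suc {suc n} b y _ bound B isB = ℕP.*-cancelʳ-≤ _ _ (q ^ suc n ∸ 1) {{^∸1-nonZero n}} (begin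
    b * numLines (suc (suc n)) * (q ^ suc n ∸ 1)           ≡⟨ ℕP.*-assoc b _ _ ⟩
    b * (numLines (suc (suc n)) * (q ^ suc n ∸ 1))         ≡⟨ cong (b *_) (numLines-suc-ratio (suc n)) ⟩
    b * (numLines (suc n) * (q ^ suc (suc (suc n)) ∸ 1))   ≡⟨ ℕP.*-assoc b _ _ ⟨
    b * numLines (suc n) * (q ^ suc (suc (suc n)) ∸ 1)     ≤⟨ restriction-average (b * numLines (suc n)) y B isB bound ⟩
    y * (length B * (q ^ suc n ∸ 1))                       ≡⟨ ℕP.*-assoc y (length B) _ ⟨
    y * length B * (q ^ suc n ∸ 1)                         ∎)
    where open ℕP.≤-Reasoning

  density-bound : ∀ {k fk n} → 1 ≤ k → IsMinBlockingSize k fk → k ≤′ n →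
                  ∀ B → IsBlockingSet n B → fk * numLines n ≤ numLines k * length B
  density-bound {k} {fk} _ (_ , minimal) ≤′-refl B isB =
    ℕP.≤-trans (ℕP.≤-reflexive (ℕP.*-comm fk (numLines k))) (ℕP.*-monoʳ-≤ (numLines k) (minimal B isB))
  density-bound {k} {fk} 1≤k isMin (≤′-step k≤′n) =
    density-bound-suc fk (numLines k) (ℕP.≤-trans 1≤k (ℕP.≤′⇒≤ k≤′n)) (density-bound 1≤k isMin k≤′n)

lemma4p7 : (F : FiniteField) → (k n fk fn : ℕ) → 2 ≤ k → k ≤ n
    → Geometry.IsMinBlockingSize F k fk → Geometry.IsMinBlockingSize F n fn
    → Geometry.ρ F k fk ≤ℚ Geometry.ρ F n fn
lemma4p7 F (suc k) (suc n) fk fn _ k≤n isMinₖ ((B , isB , |B|≡fn) , _) =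
  *≤*⇒/≤/ fk (numLines (suc k)) fn (numLines (suc n)) {{numLines-nonZero F k}} {{numLines-nonZero F n}} (begin
    fk * numLines (suc n)        ≤⟨ density-bound F (s≤s z≤n) isMinₖ (ℕP.≤⇒≤′ k≤n) B isB ⟩
    numLines (suc k) * length B  ≡⟨ ℕP.*-comm (numLines (suc k)) (length B) ⟩
    length B * numLines (suc k)  ≡⟨ cong (_* numLines (suc k)) |B|≡fn ⟩
    fn * numLines (suc k)        ∎)
  where
  open Geometry F
  open ℕP.≤-Reasoning
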